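{- Let $\mathbb{K}=(G,M,I)$ be a clarified formal context and let $\mathbb{S}_1=[H_1,N_1]$ and $\mathbb{S}_2=[H_2,N_2]$ be reduced Boolean subcontexts of dimension $k$ of $\mathbb{K}$ with $\mathbb{S}_1\ne\mathbb{S}_2$. If $H_1\ne H_2$, then $\phi_1(\mathbb{S}_1)\ne\phi_1(\mathbb{S}_2)$. If $N_1\ne N_2$, then $\phi_2(\mathbb{S}_1)\ne\phi_2(\mathbb{S}_2)$.
   Context: All sets are finite. A formal context $\mathbb{K}=(G,M,I)$ has finite $G$, $M$, $I\subseteq G\times M$; for $A\subseteq G$, $A'$ is the set of attributes common to all objects in $A$, for $B\subseteq M$, $B'$ the set of objects having all attributes in $B$; $g'=\{g\}'$. Formal concepts $(A,B)$ satisfy $A'=B$, $B'=A$. $\mathbb{K}$ is clarified if no two distinct objects $g\ne h$ have $g'=h'$ and no two distinct attributes $m\ne n$ have $m'=n'$. For $H\subseteq G$, $N\subseteq M$, $[H,N]=(H,N,I\cap(H\times N))$ with concepts computed w.r.t. its own incidence; it is a Boolean subcontext of dimension $k$ if its concept lattice is isomorphic to the concept lattice of the contranominal scale $(\{1,\dots,k\},\{1,\dots,k\},\ne)$, and it is reduced if it has no reducible object or attribute (object $g$ reducible if there is a set $X$ of objects with $g\notin X$ and $g'=X'$ in that context; dually for attributes). For a concept $(A,B)$ of $\mathbb{S}=[H,N]$, $\phi_1(A,B)=(A'',A')$, $\phi_2(A,B)=(B',B'')$ (derivations in $\mathbb{K}$), and $\phi_i(\mathbb{S})$ is the suborder $\{\phi_i(C)\mid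 C \text{ a concept of }\mathbb{S}\}$ of the concept lattice of $\mathbb{K}$. -}

module Defs where

open import Data.Nat using (ℕ; zero; suc)
open import Data.Bool using (Bool; true; false; _∧_; _∨_; not)
open import Data.Fin using (Fin; zero; suc)
open import Data.Fin.Properties using (_≟_)
open import Data.Fin.Subset using (Subset; _∈_; _∉_; _⊆_; ⁅_⁆; ⊤)
open import Data.Vec using (lookup; tabulate)
open import Data.Product using (Σ; _×_; _,_; ∃; ∃-syntax; proj₁; proj₂)
open import Function using (_∘_)
open import Function.Bundles using (_⇔_)
open import Relation.Binary.PropositionalEquality using (_≡_)
open import Relation.Nullary using (¬_)
open import Relation.Nullary.Decidable using (⌊_⌋)

allF : (n : ℕ) → (Fin n → Bool) → Bool
allF zero    f = true
allF (suc n) f = f zero ∧ allF n (f ∘ suc)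

record Context : Set where
  field
    nG : ℕ
    nM : ℕ
    I  : Fin nG → Fin nM → Bool
open Context public

Obj : Context → Set
Obj K = Fin (nG K)

Att : Context → Set
Att K = Fin (nM K)

-- Derivation operators of the subcontext [H,N] = (H, N, I ∩ (H × N)):
--   for A ⊆ H : A^S = { n ∈ N | ∀ g ∈ A, g I n }
--   for B ⊆ N : B^S = { g ∈ H | ∀ n ∈ B, g I n }
upS : (K : Context) → Subset (nG K) → Subset (nM K) → Subset (nG K) → Subset (nM K)
upS K H N A = tabulate λ j → lookup N j ∧ allF (nG K) (λ i → not (lookup A i) ∨ I K i j)

downS : (K : Context) → Subset (nG K) → Subset (nM K) → Subset (nM K) → Subset (nG K)
downS K H N B = tabulate λ i → lookup H i ∧ allF (nM K) (λ j → not (lookup B j) ∨ I K i j)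

up : (K : Context) → Subset (nG K) → Subset (nM K)
up K = upS K ⊤ ⊤

down : (K : Context) → Subset (nM K) → Subset (nG K)
down K = downS K ⊤ ⊤

record Sub (K : Context) : Set where
  constructor [_,_]
  field
    H : Subset (nG K)
    N : Subset (nM K)
open Sub public

IsConceptS : (K : Context) → Sub K → Subset (nG K) → Subset (nM K) → Set
IsConceptS K S A B =
  A ⊆ H S × B ⊆ N S × upS K (H S) (N S) A ≡ B × downS K (H S) (N S) B ≡ A

ConceptS : (K : Context) → Sub K → Set
ConceptS K S = Σ (Subset (nG K) × Subset (nM K)) λ AB → IsConceptS K S (proj₁ AB) (proj₂ AB)

extent : {K : Context} {S : Sub K} → ConceptS K S → Subset (nG K)
extent c = proj₁ (proj₁ c)

intent : {K : Context} {S : Sub K} → ConceptS K S → Subset (nM K)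
intent c = proj₂ (proj₁ c)

full : (K : Context) → Sub K
full K = [ ⊤ , ⊤ ]

Concept : Context → Set
Concept K = ConceptS K (full K)

contranominal : ℕ → Context
contranominal k = record { nG = k ; nM = k ; I = λ i j → not ⌊ i ≟ j ⌋ }

-- Order isomorphism of concept lattices (concepts ordered by extent inclusion;
-- concepts are identified by their extents).  For complete lattices, a
-- lattice isomorphism is the same as an order isomorphism.
record LatticeIso {K L : Context} (S : Sub K) (T : Sub L) : Set where
  field
    to      : ConceptS K S → ConceptS L T
    from    : ConceptS L T → ConceptS K S
    from-to : ∀ c → extent (from (to c)) ≡ extent c
    to-from : ∀ d → extent (to (from d)) ≡ extent d
    to-mono : ∀ c d → extent c ⊆ extent d → extent (to c) ⊆ extent (to d)
    to-refl : ∀ c d → extent (to c) ⊆ extent (to d) → extent c ⊆ extent d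

IsBoolean : (K : Context) → Sub K → ℕ → Set
IsBoolean K S k = LatticeIso S (full (contranominal k))

ReducibleObj : (K : Context) → Sub K → Obj K → Set
ReducibleObj K S g = ∃[ X ] (X ⊆ H S × g ∉ X ×
  upS K (H S) (N S) ⁅ g ⁆ ≡ upS K (H S) (N S) X)

ReducibleAtt : (K : Context) → Sub K → Att K → Set
ReducibleAtt K S m = ∃[ Y ] (Y ⊆ N S × m ∉ Y ×
  downS K (H S) (N S) ⁅ m ⁆ ≡ downS K (H S) (N S) Y)

IsReduced : (K : Context) → Sub K → Set
IsReduced K S =
  (∀ g → g ∈ H S → ¬ ReducibleObj K S g) × (∀ m → m ∈ N S → ¬ ReducibleAtt K S m)

IsClarified : Context → Set
IsClarified K =
  (∀ g h → up K ⁅ g ⁆ ≡ up K ⁅ h ⁆ → g ≡ h) × (∀ m n → down K ⁅ m ⁆ ≡ down K ⁅ n ⁆ → m ≡ n)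

InPhi1 : (K : Context) → Sub K → Subset (nG K) → Subset (nM K) → Set
InPhi1 K S X Y = ∃[ c ] (down K (up K (extent {K} {S} c)) ≡ X × up K (extent {K} {S} c) ≡ Y)

InPhi2 : (K : Context) → Sub K → Subset (nG K) → Subset (nM K) → Set
InPhi2 K S X Y = ∃[ c ] (down K (intent {K} {S} c) ≡ X × up K (down K (intent {K} {S} c)) ≡ Y)

-- φᵢ(S₁) = φᵢ(S₂) as suborders of the concept lattice of K (same element set,
-- induced order), i.e. same set of pairs.
SamePhi1 : (K : Context) → Sub K → Sub K → Set
SamePhi1 K S T = ∀ X Y → InPhi1 K S X Y ⇔ InPhi1 K T X Y

SamePhi2 : (K : Context) → Sub K → Sub K → Set
SamePhi2 K S T = ∀ X Y → InPhi2 K S X Y ⇔ InPhi2 K T X Y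

-- In a reduced Boolean subcontext every object concept is an atom: the closure
-- of {g} is {g}. Otherwise it contains some h ≠ g, the Boolean lattice supplies
-- the relative complement D of ⟨h⟩ below ⟨g⟩, and ⟨h⟩ ∪ D is a set of objects
-- avoiding g that still generates ⟨g⟩, so g would be reducible.
-- Now let φ₁(S₁) = φ₁(S₂) and g ∈ H₁. The image ({g}″, g′) of the atom of g is
-- the image of a concept of S₂; its extent is nonempty (else g′ = M and g is
-- reducible), so it contains some h ∈ H₂ with g′ ⊆ h′. Going back, some
-- g₂ ∈ H₁ has h′ ⊆ g₂′, whence g₂ lies in the S₁-closure {g} of g. So g′ = h′,
-- and since K is clarified g = h ∈ H₂. Thus φ₁ determines H. The statement
-- about attributes is the same argument in the transposed context, which keeps
-- both subcontexts Boolean because the contranominal scale is self-dual.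

module Submission where

open import Defs
open import Data.Nat using (ℕ)
open import Data.Product using (_×_)
open import Relation.Binary.PropositionalEquality using (_≡_)
open import Relation.Nullary using (¬_)

import Algebra.Lattice.Properties.BooleanAlgebra as BooleanAlgebraProperties
open import Data.Bool using (Bool; true; false; _∧_; _∨_; not)
open import Data.Bool.Properties using (∧-conicalˡ; ∧-conicalʳ)
open import Data.Empty using (⊥-elim)
open import Data.Fin using (Fin; zero; suc)
open import Data.Nat using (zero; suc)
open import Data.Fin.Properties using (_≟_)
open import Data.Fin.Subset using (Subset; _∈_; _∉_; _⊆_; ⁅_⁆; ⊤; ⊥; ∁; _∩_; _∪_)
open import Data.Fin.Subset.Properties
  using ( ∈⊤; ⊆⊤; ∉⊥; ⊥⊆; ⊆-refl; ⊆-trans; ⊆-reflexive; ⊆-antisym; x∈⁅x⁆; x∈⁅y⁆⇒x≡y; x≢y⇒x∉⁅y⁆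
        ; x∈∁p⇒x∉p; x∉∁p⇒x∈p; x∉p⇒x∈∁p; p⊆q⇒∁p⊇∁q; ∁p⊆∁q⇒p⊇q; p∩q⊆p; x∈p∩q⁻; x∈p∩q⁺
        ; p∩q⊆q; p⊆p∪q; q⊆p∪q; x∈p∪q⁻; _∈?_; nonempty?; Empty-unique; ∪-∩-booleanAlgebra)
open import Data.Product using (∃-syntax; _,_; proj₁; proj₂)
open import Data.Sum using ([_,_]′)
open import Data.Vec using (lookup; tabulate)
open import Data.Vec.Properties using (lookup∘tabulate; lookup⇒[]=; []=⇒lookup)
open import Function using (_∘_)
open import Function.Bundles using (Equivalence; mk⇔; _⇔_)
open import Relation.Binary.PropositionalEquality using (refl; sym; trans; cong; subst; _≢_)
open import Relation.Nullary using (yes; no; contradiction)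
open import Relation.Nullary.Decidable using (⌊_⌋)

∈-tabulate⁻ : ∀ {n} {f : Fin n → Bool} {i} → i ∈ tabulate f → f i ≡ true
∈-tabulate⁻ {f = f} {i} i∈ = trans (sym (lookup∘tabulate f i)) ([]=⇒lookup i∈)

∈-tabulate⁺ : ∀ {n} {f : Fin n → Bool} {i} → f i ≡ true → i ∈ tabulate f
∈-tabulate⁺ {f = f} {i} fi = lookup⇒[]= i (tabulate f) (trans (lookup∘tabulate f i) fi)

∧-true⁺ : ∀ {x y} → x ≡ true → y ≡ true → x ∧ y ≡ true
∧-true⁺ refl refl = refl

not-∨-true⁻ : ∀ {x y} → not x ∨ y ≡ true → x ≡ true → y ≡ true
not-∨-true⁻ {true} y≡true refl = y≡true

not-∨-true⁺ : ∀ {x y} → (x ≡ true → y ≡ true) → not x ∨ y ≡ true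
not-∨-true⁺ {true}  x⇒y = x⇒y refl
not-∨-true⁺ {false} _   = refl

allF⁻ : ∀ n {f : Fin n → Bool} → allF n f ≡ true → ∀ i → f i ≡ true
allF⁻ (suc n) all zero    = ∧-conicalˡ _ _ all
allF⁻ (suc n) all (suc i) = allF⁻ n (∧-conicalʳ _ _ all) i

allF⁺ : ∀ n {f : Fin n → Bool} → (∀ i → f i ≡ true) → allF n f ≡ true
allF⁺ zero    _   = refl
allF⁺ (suc n) all = ∧-true⁺ (all zero) (allF⁺ n (all ∘ suc))

⁅⁆⊆ : ∀ {n} {x : Fin n} {p : Subset n} → x ∈ p → ⁅ x ⁆ ⊆ p
⁅⁆⊆ {x = x} {p} x∈p y∈⁅x⁆ = subst (_∈ p) (sym (x∈⁅y⁆⇒x≡y x y∈⁅x⁆)) x∈p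

p⊆q∪[p∩∁q] : ∀ {n} (p q : Subset n) → p ⊆ q ∪ (p ∩ ∁ q)
p⊆q∪[p∩∁q] p q {i} i∈p with i ∈? q
... | yes i∈q = p⊆p∪q (p ∩ ∁ q) i∈q
... | no  i∉q = q⊆p∪q q (p ∩ ∁ q) (x∈p∩q⁺ (i∈p , x∉p⇒x∈∁p i∉q))

∁-involutive : ∀ {n} (p : Subset n) → ∁ (∁ p) ≡ p
∁-involutive {n} = BooleanAlgebraProperties.¬-involutive (∪-∩-booleanAlgebra n)

∈upS⁻ : (K : Context) (H : Subset (nG K)) (N : Subset (nM K)) (A : Subset (nG K)) {j : Att K} →
        j ∈ upS K H N A → j ∈ N × (∀ {i} → i ∈ A → I K i j ≡ true)
∈upS⁻ K _ N A {j} j∈ =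
  lookup⇒[]= j N (∧-conicalˡ _ _ j∈↑) ,
  λ {i} i∈A → not-∨-true⁻ (allF⁻ (nG K) (∧-conicalʳ _ _ j∈↑) i) ([]=⇒lookup i∈A)
  where j∈↑ = ∈-tabulate⁻ j∈

∈upS⁺ : (K : Context) (H : Subset (nG K)) (N : Subset (nM K)) (A : Subset (nG K)) {j : Att K} →
        j ∈ N → (∀ {i} → i ∈ A → I K i j ≡ true) → j ∈ upS K H N A
∈upS⁺ K _ _ _ j∈N incident = ∈-tabulate⁺
  (∧-true⁺ ([]=⇒lookup j∈N) (allF⁺ (nG K) λ i → not-∨-true⁺ (incident ∘ lookup⇒[]= i _)))

transpose : Context → Context
transpose K = record { nG = nM K ; nM = nG K ; I = λ m g → I K g m }

transposeSub : {K : Context} → Sub K → Sub (transpose K)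
transposeSub S = [ N S , H S ]

transposeConcept : {K : Context} {S : Sub K} → ConceptS K S → ConceptS (transpose K) (transposeSub S)
transposeConcept ((A , B) , A⊆H , B⊆N , ↑A≡B , ↓B≡A) = (B , A) , B⊆N , A⊆H , ↓B≡A , ↑A≡B

module Derivations (K : Context) (S : Sub K) where

  ↑ : Subset (nG K) → Subset (nM K)
  ↑ = upS K (H S) (N S)

  ↓ : Subset (nM K) → Subset (nG K)
  ↓ = downS K (H S) (N S)

  closure : Subset (nG K) → Subset (nG K)
  closure A = ↓ (↑ A)

  ∈↑⁻ : ∀ A {j} → j ∈ ↑ A → j ∈ N S × (∀ {i} → i ∈ A → I K i j ≡ true)
  ∈↑⁻ = ∈upS⁻ K (H S) (N S)

  ∈↑⁺ : ∀ A {j} → j ∈ N S → (∀ {i} → i ∈ A → I K i j ≡ true) → j ∈ ↑ A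
  ∈↑⁺ = ∈upS⁺ K (H S) (N S)

  ∈↓⁻ : ∀ B {i} → i ∈ ↓ B → i ∈ H S × (∀ {j} → j ∈ B → I K i j ≡ true)
  ∈↓⁻ = ∈upS⁻ (transpose K) (N S) (H S)

  ∈↓⁺ : ∀ B {i} → i ∈ H S → (∀ {j} → j ∈ B → I K i j ≡ true) → i ∈ ↓ B
  ∈↓⁺ = ∈upS⁺ (transpose K) (N S) (H S)

  ↑⊆N : ∀ A → ↑ A ⊆ N S
  ↑⊆N A = proj₁ ∘ ∈↑⁻ A

  ↓⊆H : ∀ B → ↓ B ⊆ H S
  ↓⊆H B = proj₁ ∘ ∈↓⁻ B

  ↑-antitone : ∀ {A A′} → A ⊆ A′ → ↑ A′ ⊆ ↑ A
  ↑-antitone {A} {A′} A⊆A′ j∈ = ∈↑⁺ A (↑⊆N A′ j∈) (proj₂ (∈↑⁻ A′ j∈) ∘ A⊆A′)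

  ↓-antitone : ∀ {B B′} → B ⊆ B′ → ↓ B′ ⊆ ↓ B
  ↓-antitone {B} {B′} B⊆B′ i∈ = ∈↓⁺ B (↓⊆H B′ i∈) (proj₂ (∈↓⁻ B′ i∈) ∘ B⊆B′)

  ∈↑⁅⁆⁻ : ∀ g {j} → j ∈ ↑ ⁅ g ⁆ → I K g j ≡ true
  ∈↑⁅⁆⁻ g j∈ = proj₂ (∈↑⁻ ⁅ g ⁆ j∈) (x∈⁅x⁆ g)

  closure-extensive : ∀ {A} → A ⊆ H S → A ⊆ closure A
  closure-extensive {A} A⊆H i∈A = ∈↓⁺ (↑ A) (A⊆H i∈A) (λ j∈↑A → proj₂ (∈↑⁻ A j∈↑A) i∈A)

  closure-monotone : ∀ {A A′} → A ⊆ A′ → closure A ⊆ closure A′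
  closure-monotone = ↓-antitone ∘ ↑-antitone

  ⊆closure⇒↑⊆↑ : ∀ A B → B ⊆ closure A → ↑ A ⊆ ↑ B
  ⊆closure⇒↑⊆↑ A B B⊆clA j∈↑A = ∈↑⁺ B (↑⊆N A j∈↑A) (λ i∈B → proj₂ (∈↓⁻ (↑ A) (B⊆clA i∈B)) j∈↑A)

  ↑-≡ : ∀ A B → A ⊆ closure B → B ⊆ closure A → ↑ A ≡ ↑ B
  ↑-≡ A B A⊆clB B⊆clA = ⊆-antisym (⊆closure⇒↑⊆↑ A B B⊆clA) (⊆closure⇒↑⊆↑ B A A⊆clB)

  ↑-closure : ∀ {A} → A ⊆ H S → ↑ (closure A) ≡ ↑ A
  ↑-closure {A} A⊆H = ↑-≡ (closure A) A ⊆-refl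
    (⊆-trans (closure-extensive A⊆H) (closure-extensive (↓⊆H (↑ A))))

  generated : (A : Subset (nG K)) → A ⊆ H S → ConceptS K S
  generated A A⊆H = (closure A , ↑ A) , ↓⊆H (↑ A) , ↑⊆N A , ↑-closure A⊆H , refl

  extent⊆H : (c : ConceptS K S) → extent c ⊆ H S
  extent⊆H c = proj₁ (proj₂ c)

  closure-extent : (c : ConceptS K S) → closure (extent c) ≡ extent c
  closure-extent (_ , _ , _ , ↑A≡B , ↓B≡A) = trans (cong ↓ ↑A≡B) ↓B≡A

  closure-least : ∀ {A} (c : ConceptS K S) → A ⊆ extent c → closure A ⊆ extent c
  closure-least c A⊆ = ⊆-trans (closure-monotone A⊆) (⊆-reflexive (closure-extent c))

  extent⊆⇒intent⊇ : (c d : ConceptS K S) → extent c ⊆ extent d → intent d ⊆ intent c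
  extent⊆⇒intent⊇ (_ , _ , _ , ↑A≡B , _) (_ , _ , _ , ↑C≡D , _) A⊆C =
    ⊆-trans (⊆-reflexive (sym ↑C≡D)) (⊆-trans (↑-antitone A⊆C) (⊆-reflexive ↑A≡B))

  reducible : ∀ {g X} → X ⊆ H S → g ∉ X → X ⊆ closure ⁅ g ⁆ → g ∈ closure X → ReducibleObj K S g
  reducible {g} {X} X⊆H g∉X X⊆cl g∈cl = X , X⊆H , g∉X , ↑-≡ ⁅ g ⁆ X (⁅⁆⊆ g∈cl) X⊆cl

up⊆up⇒∈closure⁅⁆ : ∀ {K : Context} (S : Sub K) {g h} →
                    h ∈ H S → up K ⁅ g ⁆ ⊆ up K ⁅ h ⁆ → h ∈ Derivations.closure K S ⁅ g ⁆
up⊆up⇒∈closure⁅⁆ {K} S {g} {h} h∈H g⊆h =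
  ∈↓⁺ (↑ ⁅ g ⁆) h∈H λ j∈ → ∈up⁅⁆⁻ h (g⊆h (∈up⁺ ⁅ g ⁆ ∈⊤ (proj₂ (∈↑⁻ ⁅ g ⁆ j∈))))
  where
    open Derivations K S
    open Derivations K (full K) using () renaming (∈↑⁺ to ∈up⁺; ∈↑⁅⁆⁻ to ∈up⁅⁆⁻)

ObjectReduced : (K : Context) → Sub K → Set
ObjectReduced K S = ∀ g → g ∈ H S → ¬ ReducibleObj K S g

ObjectClarified : Context → Set
ObjectClarified K = ∀ g h → up K ⁅ g ⁆ ≡ up K ⁅ h ⁆ → g ≡ h

record BooleanEmbedding (K : Context) (S : Sub K) (k : ℕ) : Set where
  field
    embed   : ConceptS K S → Subset k
    mono    : ∀ c d → extent c ⊆ extent d → embed c ⊆ embed d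
    reflect : ∀ c d → embed c ⊆ embed d → extent c ⊆ extent d
    onto    : ∀ Z → ∃[ c ] embed c ≡ Z

module _ {k : ℕ} where
  open Derivations (contranominal k) (full (contranominal k))

  contranominal-incident⁻ : ∀ {i j : Fin k} → not ⌊ i ≟ j ⌋ ≡ true → i ≢ j
  contranominal-incident⁻ {i} {j} _ i≡j with i ≟ j
  ... | no i≢j = i≢j i≡j

  contranominal-incident⁺ : ∀ {i j : Fin k} → i ≢ j → not ⌊ i ≟ j ⌋ ≡ true
  contranominal-incident⁺ {i} {j} i≢j with i ≟ j
  ... | yes i≡j = contradiction i≡j i≢j
  ... | no _    = refl

  contranominal-concept : Subset k → Concept (contranominal k)
  contranominal-concept Z = (Z , ∁ Z) , ⊆⊤ , ⊆⊤ , ↑Z≡∁Z , ↓∁Z≡Z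
    where
      ↑Z≡∁Z : ↑ Z ≡ ∁ Z
      ↑Z≡∁Z = ⊆-antisym
        (λ j∈↑Z → x∉p⇒x∈∁p (λ j∈Z → contranominal-incident⁻ (proj₂ (∈↑⁻ Z j∈↑Z) j∈Z) refl))
        (λ j∈∁Z → ∈↑⁺ Z ∈⊤ (λ i∈Z → contranominal-incident⁺ λ { refl → x∈∁p⇒x∉p j∈∁Z i∈Z }))
      ↓∁Z≡Z : ↓ (∁ Z) ≡ Z
      ↓∁Z≡Z = ⊆-antisym
        (λ i∈↓ → x∉∁p⇒x∈p (λ i∈∁Z → contranominal-incident⁻ (proj₂ (∈↓⁻ (∁ Z) i∈↓) i∈∁Z) refl))
        (λ i∈Z → ∈↓⁺ (∁ Z) ∈⊤ (λ j∈∁Z → contranominal-incident⁺ λ { refl → x∈∁p⇒x∉p j∈∁Z i∈Z }))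

module _ {K : Context} {S : Sub K} {k : ℕ} (boolean : IsBoolean K S k) where
  open LatticeIso boolean

  IsBoolean⇒BooleanEmbedding : BooleanEmbedding K S k
  IsBoolean⇒BooleanEmbedding = record
    { embed   = extent ∘ to
    ; mono    = to-mono
    ; reflect = to-refl
    ; onto    = λ Z → from (contranominal-concept Z) , to-from (contranominal-concept Z)
    }

  -- Transposition reverses the order of concepts; complementation reverses it back.
  IsBoolean⇒BooleanEmbedding-transpose : BooleanEmbedding (transpose K) (transposeSub S) k
  IsBoolean⇒BooleanEmbedding-transpose = record
    { embed   = λ c → ∁ (extent (to (transposeConcept c)))
    ; mono    = λ c d c⊆d → p⊆q⇒∁p⊇∁q (to-mono (transposeConcept d) (transposeConcept c)
                  (Derivations.extent⊆⇒intent⊇ (transpose K) (transposeSub S) c d c⊆d))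
    ; reflect = λ c d ∁c⊆∁d → Derivations.extent⊆⇒intent⊇ K S (transposeConcept d) (transposeConcept c)
                  (to-refl (transposeConcept d) (transposeConcept c) (∁p⊆∁q⇒p⊇q ∁c⊆∁d))
    ; onto    = λ Z → transposeConcept (from (contranominal-concept (∁ Z))) ,
                  trans (cong ∁ (to-from (contranominal-concept (∁ Z)))) (∁-involutive Z)
    }

module ReducedBoolean {K : Context} {S : Sub K} (reduced : ObjectReduced K S)
                      {k : ℕ} (boolean : BooleanEmbedding K S k) where
  open Derivations K S
  open BooleanEmbedding boolean

  ∉closure⊥ : ∀ {g} → g ∈ H S → g ∉ closure ⊥
  ∉closure⊥ g∈H g∈cl⊥ = reduced _ g∈H (reducible ⊥⊆ ∉⊥ ⊥⊆ g∈cl⊥)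

  embed-disjoint⇒extent⊆closure⊥ : ∀ c d → embed d ⊆ ∁ (embed c) → extent c ⊆ extent d →
                                   extent c ⊆ closure ⊥
  embed-disjoint⇒extent⊆closure⊥ c d d⊆∁c c⊆d = reflect c (generated ⊥ ⊥⊆)
    λ i∈c → contradiction i∈c (x∈∁p⇒x∉p (d⊆∁c (mono c d c⊆d i∈c)))

  embed⊆∪⇒extent⊆closure∪ : ∀ c d e → embed c ⊆ embed d ∪ embed e →
                             extent c ⊆ closure (extent d ∪ extent e)
  embed⊆∪⇒extent⊆closure∪ c d e c⊆d∪e = reflect c W
    (⊆-trans c⊆d∪e λ i∈ → [ mono d W (⊆-trans (p⊆p∪q (extent e)) U⊆W)
                           , mono e W (⊆-trans (q⊆p∪q (extent d) (extent e)) U⊆W)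
                           ]′ (x∈p∪q⁻ (embed d) (embed e) i∈))
    where
      U⊆H : extent d ∪ extent e ⊆ H S
      U⊆H i∈ = [ extent⊆H d , extent⊆H e ]′ (x∈p∪q⁻ (extent d) (extent e) i∈)
      W = generated (extent d ∪ extent e) U⊆H
      U⊆W : extent d ∪ extent e ⊆ extent W
      U⊆W = closure-extensive U⊆H

  ∈closure⁅⁆⇒≡ : ∀ {g h} → g ∈ H S → h ∈ closure ⁅ g ⁆ → h ≡ g
  ∈closure⁅⁆⇒≡ {g} {h} g∈H h∈x with h ≟ g
  ... | yes h≡g = h≡g
  ... | no h≢g  = ⊥-elim (reduced g g∈H (reducible U⊆H g∉U U⊆x g∈closureU))
    where
      x = generated ⁅ g ⁆ (⁅⁆⊆ g∈H)
      h∈H = extent⊆H x h∈x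
      y = generated ⁅ h ⁆ (⁅⁆⊆ h∈H)

      y⊆x : extent y ⊆ extent x
      y⊆x = closure-least x (⁅⁆⊆ h∈x)

      g∉y : g ∉ extent y
      g∉y = reduced g g∈H ∘ reducible (⁅⁆⊆ h∈H) (x≢y⇒x∉⁅y⁆ (h≢g ∘ sym)) (⁅⁆⊆ h∈x)

      D = proj₁ (onto (embed x ∩ ∁ (embed y)))
      embed-D≡ : embed D ≡ embed x ∩ ∁ (embed y)
      embed-D≡ = proj₂ (onto (embed x ∩ ∁ (embed y)))

      D⊆x : extent D ⊆ extent x
      D⊆x = reflect D x (⊆-trans (⊆-reflexive embed-D≡) (p∩q⊆p (embed x) (∁ (embed y))))

      g∉D : g ∉ extent D
      g∉D g∈D = ∉closure⊥ h∈H (embed-disjoint⇒extent⊆closure⊥ y D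
        (⊆-trans (⊆-reflexive embed-D≡) (p∩q⊆q (embed x) (∁ (embed y))))
        (⊆-trans y⊆x (closure-least D (⁅⁆⊆ g∈D)))
        (closure-extensive (⁅⁆⊆ h∈H) (x∈⁅x⁆ h)))

      U = extent y ∪ extent D
      U⊆x : U ⊆ extent x
      U⊆x i∈U = [ y⊆x , D⊆x ]′ (x∈p∪q⁻ (extent y) (extent D) i∈U)
      U⊆H = ⊆-trans U⊆x (extent⊆H x)
      g∉U : g ∉ U
      g∉U g∈U = [ g∉y , g∉D ]′ (x∈p∪q⁻ (extent y) (extent D) g∈U)

      g∈closureU : g ∈ closure U
      g∈closureU = embed⊆∪⇒extent⊆closure∪ x y D
        (subst (λ V → embed x ⊆ embed y ∪ V) (sym embed-D≡) (p⊆q∪[p∩∁q] (embed x) (embed y)))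
        (closure-extensive (⁅⁆⊆ g∈H) (x∈⁅x⁆ g))

  closure⁅⁆≡⁅⁆ : ∀ {g} → g ∈ H S → closure ⁅ g ⁆ ≡ ⁅ g ⁆
  closure⁅⁆≡⁅⁆ {g} g∈H = ⊆-antisym
    (λ h∈ → subst (_∈ ⁅ g ⁆) (sym (∈closure⁅⁆⇒≡ g∈H h∈)) (x∈⁅x⁆ g))
    (closure-extensive (⁅⁆⊆ g∈H))

  open Derivations K (full K) using () renaming (∈↑⁺ to ∈up⁺; ∈↑⁅⁆⁻ to ∈up⁅⁆⁻; ↑-antitone to up-antitone)

  InPhi1-transfer : ∀ {T : Sub K} → (∀ X Y → InPhi1 K S X Y → InPhi1 K T X Y) →
                    ∀ {g} → g ∈ H S → ∃[ h ] h ∈ H T × up K ⁅ g ⁆ ⊆ up K ⁅ h ⁆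
  InPhi1-transfer {T} incl {g} g∈H with incl _ _ (generated ⁅ g ⁆ (⁅⁆⊆ g∈H) , refl , refl)
  ... | d , _ , up-d≡up-x with nonempty? (extent d)
  ... | yes (h , h∈d) =
    h , Derivations.extent⊆H K T d h∈d , ⊆-trans (⊆-reflexive up-g≡up-d) (up-antitone (⁅⁆⊆ h∈d))
    where
      up-g≡up-d : up K ⁅ g ⁆ ≡ up K (extent d)
      up-g≡up-d = trans (cong (up K) (sym (closure⁅⁆≡⁅⁆ g∈H))) (sym up-d≡up-x)
  ... | no d-empty = contradiction (∈↓⁺ (↑ ⊥) g∈H incident) (∉closure⊥ g∈H)
    where
      -- an empty extent forces g′ = M
      up-⊥≡up-g : up K ⊥ ≡ up K ⁅ g ⁆
      up-⊥≡up-g = trans (cong (up K) (sym (Empty-unique d-empty)))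
                        (trans up-d≡up-x (cong (up K) (closure⁅⁆≡⁅⁆ g∈H)))
      incident : ∀ {j} → j ∈ ↑ ⊥ → I K g j ≡ true
      incident {j} _ = ∈up⁅⁆⁻ g (subst (j ∈_) up-⊥≡up-g (∈up⁺ ⊥ ∈⊤ (λ i∈⊥ → contradiction i∈⊥ ∉⊥)))

module _ {K : Context} (clarified : ObjectClarified K) {k : ℕ} {S T : Sub K}
         (reducedS : ObjectReduced K S) (booleanS : BooleanEmbedding K S k)
         (reducedT : ObjectReduced K T) (booleanT : BooleanEmbedding K T k) where

  InPhi1-transfers⇒H⊆H : (∀ X Y → InPhi1 K S X Y → InPhi1 K T X Y) →
                          (∀ X Y → InPhi1 K T X Y → InPhi1 K S X Y) → H S ⊆ H T
  InPhi1-transfers⇒H⊆H S→T T→S {g} g∈S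
    with ReducedBoolean.InPhi1-transfer reducedS booleanS S→T g∈S
  ... | h , h∈T , g⊆h with ReducedBoolean.InPhi1-transfer reducedT booleanT T→S h∈T
  ... | g₂ , g₂∈S , h⊆g₂ = subst (_∈ H T) (sym g≡h) h∈T
    where
      g₂≡g : g₂ ≡ g
      g₂≡g = ReducedBoolean.∈closure⁅⁆⇒≡ reducedS booleanS g∈S
               (up⊆up⇒∈closure⁅⁆ S {g} g₂∈S (⊆-trans g⊆h h⊆g₂))
      g≡h : g ≡ h
      g≡h = clarified g h (⊆-antisym g⊆h (subst (λ z → up K ⁅ h ⁆ ⊆ up K ⁅ z ⁆) g₂≡g h⊆g₂))

SamePhi1⇒H≡H : (K : Context) → ObjectClarified K → ∀ {k} (S T : Sub K) →
               ObjectReduced K S → BooleanEmbedding K S k →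
               ObjectReduced K T → BooleanEmbedding K T k →
               SamePhi1 K S T → H S ≡ H T
SamePhi1⇒H≡H K clarified S T reducedS booleanS reducedT booleanT same = ⊆-antisym
  (InPhi1-transfers⇒H⊆H clarified reducedS booleanS reducedT booleanT S→T T→S)
  (InPhi1-transfers⇒H⊆H clarified reducedT booleanT reducedS booleanS T→S S→T)
  where
    S→T = λ X Y → Equivalence.to (same X Y)
    T→S = λ X Y → Equivalence.from (same X Y)

InPhi1-transpose : ∀ {K : Context} {S : Sub K} {X Y} →
                   InPhi1 (transpose K) (transposeSub S) X Y ⇔ InPhi2 K S Y X
InPhi1-transpose = mk⇔ (λ (c , e₁ , e₂) → transposeConcept c , e₂ , e₁)
                       (λ (c , e₁ , e₂) → transposeConcept c , e₂ , e₁)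

SamePhi2⇒SamePhi1-transpose : ∀ {K : Context} {S T : Sub K} →
                              SamePhi2 K S T → SamePhi1 (transpose K) (transposeSub S) (transposeSub T)
SamePhi2⇒SamePhi1-transpose same X Y = mk⇔
  (Equivalence.from InPhi1-transpose ∘ Equivalence.to (same Y X) ∘ Equivalence.to InPhi1-transpose)
  (Equivalence.from InPhi1-transpose ∘ Equivalence.from (same Y X) ∘ Equivalence.to InPhi1-transpose)

lemma12 : (K : Context) → IsClarified K → (k : ℕ) → (S₁ S₂ : Sub K)
    → IsBoolean K S₁ k → IsReduced K S₁
    → IsBoolean K S₂ k → IsReduced K S₂
    → ¬ (H S₁ ≡ H S₂ × N S₁ ≡ N S₂)
    → (¬ H S₁ ≡ H S₂ → ¬ SamePhi1 K S₁ S₂)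
      × (¬ N S₁ ≡ N S₂ → ¬ SamePhi2 K S₁ S₂)
lemma12 K (clarifiedG , clarifiedM) k S₁ S₂
        boolean₁ (reducedG₁ , reducedM₁) boolean₂ (reducedG₂ , reducedM₂) _ =
  (λ H≢H same → H≢H (SamePhi1⇒H≡H K clarifiedG S₁ S₂
      reducedG₁ (IsBoolean⇒BooleanEmbedding boolean₁)
      reducedG₂ (IsBoolean⇒BooleanEmbedding boolean₂) same)) ,
  (λ N≢N same → N≢N (SamePhi1⇒H≡H (transpose K) clarifiedM (transposeSub S₁) (transposeSub S₂)
      reducedM₁ (IsBoolean⇒BooleanEmbedding-transpose boolean₁)
      reducedM₂ (IsBoolean⇒BooleanEmbedding-transpose boolean₂)
      (SamePhi2⇒SamePhi1-transpose same)))
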